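{- Let $k$ and $n$ be positive integers, let $T$ be a tree with at least $k$ edges, and let $w$ be a $k$-local positive weighing of $T$. Then every connected subgraph of $T$ with exactly $n$ edges has weight at least $g(n,k)$. In particular, if $T$ has $n$ edges, then $w(T) \ge g(n,k)$.
   Context: A weighing of a graph $G$ is a function $w: E(G) \to \{ -1,1\}$; the weight of a subgraph $H$ is $w(H)=\sum_{e\in E(H)} w(e)$. $w$ is $k$-local positive if $w(H)>0$ for every connected subgraph $H$ of $G$ with exactly $k$ edges. For fixed positive integer $k$, the function $g(n,k)$ on positive integers $n$ is defined as follows: $g(n,k)=-n$ for $n=1,\ldots,\lfloor (k-1)/2\rfloor$; if $k$ is odd, $g(n,k)=n-k+1$ for $n=(k+1)/2,\ldots,k$; if $k$ is even, $g(n,k)=n-k+2$ for $n=k/2,\ldots,k$; and for $n>k$, $$g(n,k)=\max\Big\{\, g(n-1,k)-1,\ \min_{j=\lceil n/3\rceil}^{\lfloor n/2\rfloor} \big(g(n-j,k)+g(j,k)\big) \Big\}.$$ -}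

module Defs where

open import Data.Nat as ℕ using (ℕ; zero; suc; _<ᵇ_; _≤ᵇ_; _≡ᵇ_; _∸_; _/_; _%_)
open import Data.Integer as ℤ using (ℤ; +_; -_; _⊔_; _⊓_; 0ℤ; 1ℤ; -1ℤ)
open import Data.Bool using (Bool; true; false; if_then_else_)
open import Data.Fin using (Fin; zero; suc; inject₁; fromℕ)
open import Data.Fin.Subset using (Subset; _∈_; ⊤)
open import Data.Vec using (lookup)
open import Data.Product using (_×_; Σ; ∃; ∃-syntax; proj₁; proj₂; _,_)
open import Data.Sum using (_⊎_)
open import Relation.Binary.PropositionalEquality using (_≡_; _≢_)
open import Function.Definitions using (Injective)

minRange : (ℕ → ℤ) → ℕ → ℕ → ℤ
minRange f lo zero    = f lo
minRange f lo (suc c) = f lo ⊓ minRange f (suc lo) c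

-- Every recursive call is on arguments in 1..n-1, so fuel = n suffices
-- (the fuel-0 clause is only reached for the meaningless value n = 0).
gF : ℕ → ℕ → ℕ → ℤ
gF zero    n k = 0ℤ
gF (suc f) n k =
  if 2 ℕ.* n <ᵇ k                 -- n ≤ ⌊(k-1)/2⌋
  then - (+ n)
  else if n ≤ᵇ k
  then (if k % 2 ≡ᵇ 1
        then (+ n) ℤ.- (+ k) ℤ.+ 1ℤ
        else (+ n) ℤ.- (+ k) ℤ.+ (+ 2))
  else ((gF f (n ∸ 1) k ℤ.- 1ℤ)
        ⊔ minRange (λ j → gF f (n ∸ j) k ℤ.+ gF f j k)
                   ((n ℕ.+ 2) / 3)                   -- ⌈n/3⌉
                   ((n / 2) ∸ ((n ℕ.+ 2) / 3)))       -- up to ⌊n/2⌋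

g : ℕ → ℕ → ℤ
g n k = gF n n k

record Graph : Set where
  field
    V    : ℕ
    m    : ℕ
    ends : Fin m → Fin V × Fin V

open Graph public

Joins : ∀ {V} → Fin V × Fin V → Fin V → Fin V → Set
Joins (a , b) u x = (a ≡ u × b ≡ x) ⊎ (a ≡ x × b ≡ u)

IsSimple : Graph → Set
IsSimple G =
  (∀ e → proj₁ (ends G e) ≢ proj₂ (ends G e)) ×
  (∀ e f → Joins (ends G e) (proj₁ (ends G f)) (proj₂ (ends G f)) → e ≡ f)

Adjacent : (G : Graph) → Fin (V G) → Fin (V G) → Set
Adjacent G u v = ∃[ e ] Joins (ends G e) u v

data Reach (G : Graph) (S : Subset (m G)) : Fin (V G) → Fin (V G) → Set where
  here : ∀ {u} → Reach G S u u
  step : ∀ {u x v} (e : Fin (m G)) → e ∈ S → Joins (ends G e) u x →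
         Reach G S x v → Reach G S u v

-- the subgraph of G formed by the edge set S (with the vertices incident
-- to these edges) is connected
ConnectedSub : (G : Graph) → Subset (m G) → Set
ConnectedSub G S = ∀ e f → e ∈ S → f ∈ S →
  Reach G S (proj₁ (ends G e)) (proj₁ (ends G f))

IsConnected : Graph → Set
IsConnected G = ∀ u v → Reach G ⊤ u v

-- a cycle: distinct vertices c 0, ..., c l  (l ≥ 2, i.e. at least 3 vertices)
-- with c i ~ c (i+1) and c l ~ c 0
record Cycle (G : Graph) : Set where
  field
    l      : ℕ
    3≤len  : 2 ℕ.≤ l
    c      : Fin (suc l) → Fin (V G)
    inj    : Injective _≡_ _≡_ c
    consec : ∀ (i : Fin l) → Adjacent G (c (inject₁ i)) (c (suc i))
    close  : Adjacent G (c (fromℕ l)) (c zero)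

IsAcyclic : Graph → Set
IsAcyclic G = Cycle G → Data.Empty.⊥
  where import Data.Empty

IsTree : Graph → Set
IsTree G = IsSimple G × IsConnected G × IsAcyclic G

IsWeighing : (G : Graph) → (Fin (m G) → ℤ) → Set
IsWeighing G w = ∀ e → w e ≡ 1ℤ ⊎ w e ≡ -1ℤ

sumFin : ∀ {m} → (Fin m → ℤ) → ℤ
sumFin {zero}  f = 0ℤ
sumFin {suc m} f = f zero ℤ.+ sumFin (λ i → f (suc i))

weight : (G : Graph) → (Fin (m G) → ℤ) → Subset (m G) → ℤ
weight G w S = sumFin (λ e → if lookup S e then w e else 0ℤ)

nEdges : ∀ {m} → Subset m → ℕ
nEdges = Data.Fin.Subset.∣_∣
  where import Data.Fin.Subset

LocalPositive : ℕ → (G : Graph) → (Fin (m G) → ℤ) → Set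
LocalPositive k G w = ∀ (S : Subset (m G)) → nEdges S ≡ k → ConnectedSub G S →
  0ℤ ℤ.< weight G w S

module Submission where

-- The proof follows the recursion defining g, by induction on its fuel:
--   * n ≤ (k−1)/2: every edge weighs at least −1;
--   * n ≤ k: extend the subgraph to a connected one with k edges, which has
--     positive weight (even, hence at least 2, when k is even), while the k − n
--     added edges weigh at most k − n;
--   * n > k, first term: remove one edge keeping the rest connected;
--   * n > k, second term: cut off a connected piece A whose complement stays
--     connected, with |A| = ⌈n/3⌉ or ⌈n/3⌉ ≤ |A| ≤ 2⌈n/3⌉ − 2; then |A| or n − |A|
--     lies in [⌈n/3⌉, ⌊n/2⌋], and both parts are bounded by induction.

open import Defs
import Data.Nat as ℕ
open import Data.Nat
  using (ℕ; zero; suc; _+_; _*_; _∸_; _/_; _%_; _≤_; _<_; _≤?_; _<?_; z≤n; s≤s; _<ᵇ_; _≤ᵇ_; _≡ᵇ_)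
import Data.Nat.Properties as ℕP
open import Data.Nat.DivMod using (m≡m%n+[m/n]*n; m%n<n; m/n*n≤m)
open import Data.Integer using (ℤ; +_; -_; 0ℤ; 1ℤ; -1ℤ; _⊔_)
  renaming (_+_ to _+ℤ_; _-_ to _-ℤ_; _≤_ to _≤ℤ_; _<_ to _<ℤ_)
import Data.Integer.Properties as ℤP
open import Data.Bool using (true; false; T; if_then_else_)
open import Data.Fin using (Fin; zero; suc)
import Data.Fin.Properties as FinP
open import Data.Fin.Subset
open import Data.Fin.Subset.Properties
open import Data.Vec using ([]; _∷_; here; there; lookup)
open import Data.Product using (_×_; _,_; proj₁; proj₂; ∃; ∃-syntax)
open import Data.Sum using (_⊎_; inj₁; inj₂)
open import Data.Empty using (⊥-elim)
open import Relation.Nullary using (¬_; Dec; yes; no)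
open import Relation.Nullary.Decidable using (_×-dec_; _⊎-dec_; ¬?)
open import Relation.Binary.PropositionalEquality
import Data.Nat.Tactic.RingSolver as ℕRing
import Data.Integer.Tactic.RingSolver as ℤRing

-- The weight of an edge set; `weight G w S` unfolds to `wt w S`.
wt : ∀ {m} → (Fin m → ℤ) → Subset m → ℤ
wt w S = sumFin (λ e → if lookup S e then w e else 0ℤ)

wt-split : ∀ {m} (w : Fin m → ℤ) (S A : Subset m) → A ⊆ S →
           wt w S ≡ wt w A +ℤ wt w (S ─ A)
wt-split w [] [] _ = refl
wt-split {suc m} w (true ∷ S) (true ∷ A) A⊆S =
  trans (cong (w zero +ℤ_) (wt-split w⁺ S A (drop-∷-⊆ A⊆S)))
        (regroup (w zero) (wt w⁺ A) (wt w⁺ (S ─ A)))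
  where
  w⁺ : Fin m → ℤ
  w⁺ i = w (suc i)
  regroup : ∀ a b c → a +ℤ (b +ℤ c) ≡ (a +ℤ b) +ℤ (0ℤ +ℤ c)
  regroup = ℤRing.solve-∀
wt-split {suc m} w (true ∷ S) (false ∷ A) A⊆S =
  trans (cong (w zero +ℤ_) (wt-split w⁺ S A (drop-∷-⊆ A⊆S)))
        (regroup (w zero) (wt w⁺ A) (wt w⁺ (S ─ A)))
  where
  w⁺ : Fin m → ℤ
  w⁺ i = w (suc i)
  regroup : ∀ a b c → a +ℤ (b +ℤ c) ≡ (0ℤ +ℤ b) +ℤ (a +ℤ c)
  regroup = ℤRing.solve-∀
wt-split w (false ∷ S) (true ∷ A) A⊆S with A⊆S here
... | ()
wt-split {suc m} w (false ∷ S) (false ∷ A) A⊆S =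
  trans (cong (0ℤ +ℤ_) (wt-split w⁺ S A (drop-∷-⊆ A⊆S)))
        (regroup (wt w⁺ A) (wt w⁺ (S ─ A)))
  where
  w⁺ : Fin m → ℤ
  w⁺ i = w (suc i)
  regroup : ∀ b c → 0ℤ +ℤ (b +ℤ c) ≡ (0ℤ +ℤ b) +ℤ (0ℤ +ℤ c)
  regroup = ℤRing.solve-∀

card-split : ∀ {m} (S A : Subset m) → A ⊆ S → ∣ S ∣ ≡ ∣ A ∣ + ∣ S ─ A ∣
card-split [] [] _ = refl
card-split (true ∷ S) (true ∷ A) A⊆S = cong suc (card-split S A (drop-∷-⊆ A⊆S))
card-split (true ∷ S) (false ∷ A) A⊆S =
  trans (cong suc (card-split S A (drop-∷-⊆ A⊆S))) (sym (ℕP.+-suc _ _))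
card-split (false ∷ S) (true ∷ A) A⊆S with A⊆S here
... | ()
card-split (false ∷ S) (false ∷ A) A⊆S = card-split S A (drop-∷-⊆ A⊆S)

card-diff : ∀ {m} (S A : Subset m) → A ⊆ S → ∣ S ─ A ∣ ≡ ∣ S ∣ ∸ ∣ A ∣
card-diff S A A⊆S =
  trans (sym (ℕP.m+n∸m≡n ∣ A ∣ ∣ S ─ A ∣)) (cong (_∸ ∣ A ∣) (sym (card-split S A A⊆S)))

x∈p─q⁻ : ∀ {m} {x : Fin m} (p q : Subset m) → x ∈ p ─ q → x ∈ p × x ∉ q
x∈p─q⁻ {x = zero} (true ∷ p) (false ∷ q) here = here , λ ()
x∈p─q⁻ {x = suc x} (_ ∷ p) (_ ∷ q) (there x∈) =
  there (proj₁ (x∈p─q⁻ p q x∈)) , λ x∈q → proj₂ (x∈p─q⁻ p q x∈) (drop-there x∈q)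

nonempty : ∀ {m} (p : Subset m) → 1 ≤ ∣ p ∣ → Nonempty p
nonempty (true ∷ p) _ = zero , here
nonempty (false ∷ p) 1≤p with nonempty p 1≤p
... | x , x∈p = suc x , there x∈p

missing : ∀ {m} (S A : Subset m) → A ⊆ S → ∣ A ∣ < ∣ S ∣ → ∃ λ x → x ∈ S × x ∉ A
missing S A A⊆S A<S with nonempty (S ─ A) (subst (1 ≤_) (sym (card-diff S A A⊆S)) (ℕP.m<n⇒0<n∸m A<S))
... | x , x∈ = x , x∈p─q⁻ S A x∈

card-insert : ∀ {m} (A : Subset m) (f : Fin m) → f ∉ A → ∣ A ∪ ⁅ f ⁆ ∣ ≡ suc ∣ A ∣
card-insert (false ∷ A) zero f∉A = cong suc (cong ∣_∣ (∪-identityʳ A))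
card-insert (true ∷ A) zero f∉A = ⊥-elim (f∉A here)
card-insert (true ∷ A) (suc f) f∉A = cong suc (card-insert A f (λ f∈ → f∉A (there f∈)))
card-insert (false ∷ A) (suc f) f∉A = card-insert A f (λ f∈ → f∉A (there f∈))

∪-⊆ : ∀ {n} {A B C : Subset n} → A ⊆ C → B ⊆ C → A ∪ B ⊆ C
∪-⊆ {A = A} {B} A⊆C B⊆C h∈ with x∈p∪q⁻ A B h∈
... | inj₁ h∈A = A⊆C h∈A
... | inj₂ h∈B = B⊆C h∈B

⁅⁆-⊆ : ∀ {n} {g : Fin n} {U} → g ∈ U → ⁅ g ⁆ ⊆ U
⁅⁆-⊆ {g = g} {U} g∈U h∈ = subst (_∈ U) (sym (x∈⁅y⁆⇒x≡y g h∈)) g∈U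

∈-insert : ∀ {n} (A : Subset n) (g : Fin n) → g ∈ A ∪ ⁅ g ⁆
∈-insert A g = x∈p∪q⁺ (inj₂ (x∈⁅x⁆ g))

SignCount : ∀ {m} → (Fin m → ℤ) → Subset m → Set
SignCount w S = ∃[ a ] ∃[ b ] (a + b ≡ ∣ S ∣ × wt w S ≡ + a -ℤ + b)

sign-count : ∀ {m} (w : Fin m → ℤ) → (∀ e → w e ≡ 1ℤ ⊎ w e ≡ -1ℤ) →
             (S : Subset m) → SignCount w S
sign-count w ±1 [] = 0 , 0 , refl , refl
sign-count w ±1 (false ∷ S) with sign-count (λ i → w (suc i)) (λ i → ±1 (suc i)) S
... | a , b , size , weight = a , b , size , trans (ℤP.+-identityˡ _) weight
sign-count w ±1 (true ∷ S) with sign-count (λ i → w (suc i)) (λ i → ±1 (suc i)) S | ±1 zero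
... | a , b , size , weight | inj₁ plus =
  suc a , b , cong suc size , trans (cong₂ _+ℤ_ plus weight) (one+ (+ a) (+ b))
  where
  one+ : ∀ x y → 1ℤ +ℤ (x -ℤ y) ≡ (1ℤ +ℤ x) -ℤ y
  one+ = ℤRing.solve-∀
... | a , b , size , weight | inj₂ minus =
  a , suc b , trans (ℕP.+-suc a b) (cong suc size) , trans (cong₂ _+ℤ_ minus weight) (minus1+ (+ a) (+ b))
  where
  minus1+ : ∀ x y → -1ℤ +ℤ (x -ℤ y) ≡ x -ℤ (1ℤ +ℤ y)
  minus1+ = ℤRing.solve-∀

diff-≤ : ∀ x y r s → x + s ≤ r + y → + x -ℤ + y ≤ℤ + r -ℤ + s
diff-≤ x y r s x+s≤r+y =
  subst₂ _≤ℤ_ (shift (+ x) (+ y) (+ s)) (cancel (+ r) (+ y) (+ s))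
    (ℤP.+-monoˡ-≤ (- (+ (y + s))) (Data.Integer.+≤+ x+s≤r+y))
  where
  shift : ∀ x y s → (x +ℤ s) -ℤ (y +ℤ s) ≡ x -ℤ y
  shift = ℤRing.solve-∀
  cancel : ∀ r y s → (r +ℤ y) -ℤ (y +ℤ s) ≡ r -ℤ s
  cancel = ℤRing.solve-∀

diff-pos : ∀ x y → 0ℤ <ℤ + x -ℤ + y → y < x
diff-pos x y 0<x-y with y <? x
... | yes y<x = y<x
... | no y≮x =
  ⊥-elim (ℤP.<⇒≱ 0<x-y (diff-≤ x y 0 0 (subst (_≤ y) (sym (ℕP.+-identityʳ x)) (ℕP.≮⇒≥ y≮x))))

module SignBounds {m} (w : Fin m → ℤ) (±1 : ∀ e → w e ≡ 1ℤ ⊎ w e ≡ -1ℤ) where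

  wt-≥-size : (S : Subset m) → - (+ ∣ S ∣) ≤ℤ wt w S
  wt-≥-size S with sign-count w ±1 S
  ... | a , b , size , weight rewrite weight | sym size =
    subst (_≤ℤ + a -ℤ + b) (ℤP.+-identityˡ (- (+ (a + b))))
      (diff-≤ 0 (a + b) a b (ℕP.≤-trans (ℕP.m≤n+m b a) (ℕP.m≤n+m (a + b) a)))

  wt-≤-size : (S : Subset m) → wt w S ≤ℤ + ∣ S ∣
  wt-≤-size S with sign-count w ±1 S
  ... | a , b , size , weight rewrite weight | sym size =
    subst (+ a -ℤ + b ≤ℤ_) (ℤP.+-identityʳ (+ (a + b)))
      (diff-≤ a b (a + b) 0 (ℕP.≤-trans (ℕP.+-monoʳ-≤ a z≤n) (ℕP.m≤m+n (a + b) b)))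

  -- An edge set of even size has even weight, so a positive one weighs at least 2.
  wt-even-positive : (S : Subset m) (q : ℕ) → ∣ S ∣ ≡ 2 * q → 0ℤ <ℤ wt w S → + 2 ≤ℤ wt w S
  wt-even-positive S q even positive with sign-count w ±1 S
  ... | a , b , size , weight rewrite weight =
    diff-≤ 2 0 a b (subst (2 + b ≤_) (sym (ℕP.+-identityʳ a)) 2+b≤a)
    where
    b<a : b < a
    b<a = diff-pos a b positive
    a≢1+b : a ≢ suc b
    a≢1+b refl = ℕP.even≢odd q b (trans (sym even) (trans (sym size) (solve b)))
      where
      solve : ∀ b → suc b + b ≡ suc (2 * b)
      solve = ℕRing.solve-∀
    2+b≤a : 2 + b ≤ a
    2+b≤a = ℕP.≤∧≢⇒< b<a (λ eq → a≢1+b (sym eq))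

joins-sym : ∀ {n} {p : Fin n × Fin n} {u x} → Joins p u x → Joins p x u
joins-sym (inj₁ (a , b)) = inj₂ (a , b)
joins-sym (inj₂ (a , b)) = inj₁ (a , b)

endpoint-left : ∀ {n} {p : Fin n × Fin n} {u y} → Joins p u y → proj₁ p ≡ u ⊎ proj₂ p ≡ u
endpoint-left (inj₁ (a , _)) = inj₁ a
endpoint-left (inj₂ (_ , b)) = inj₂ b

endpoint-right : ∀ {n} {p : Fin n × Fin n} {u y} → Joins p u y → proj₁ p ≡ y ⊎ proj₂ p ≡ y
endpoint-right (inj₁ (_ , b)) = inj₂ b
endpoint-right (inj₂ (a , _)) = inj₁ a

endpoint-of : ∀ {n} {p : Fin n × Fin n} {r c u} → Joins p r c →
              proj₁ p ≡ u ⊎ proj₂ p ≡ u → u ≡ r ⊎ u ≡ c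
endpoint-of (inj₁ (a , b)) (inj₁ x) = inj₁ (trans (sym x) a)
endpoint-of (inj₁ (a , b)) (inj₂ x) = inj₂ (trans (sym x) b)
endpoint-of (inj₂ (a , b)) (inj₁ x) = inj₂ (trans (sym x) a)
endpoint-of (inj₂ (a , b)) (inj₂ x) = inj₁ (trans (sym x) b)

module Walks (G : Graph) where

  tail head : Fin (m G) → Fin (V G)
  tail e = proj₁ (ends G e)
  head e = proj₂ (ends G e)

  joins-ends : ∀ e → Joins (ends G e) (tail e) (head e)
  joins-ends e = inj₁ (refl , refl)

  reach-mono : ∀ {S S'} → S ⊆ S' → ∀ {u v} → Reach G S u v → Reach G S' u v
  reach-mono S⊆S' here = here
  reach-mono S⊆S' (step e e∈ j r) = step e (S⊆S' e∈) j (reach-mono S⊆S' r)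

  reach-trans : ∀ {S u v x} → Reach G S u v → Reach G S v x → Reach G S u x
  reach-trans here r = r
  reach-trans (step e e∈ j r) r' = step e e∈ j (reach-trans r r')

  reach-sym : ∀ {S u v} → Reach G S u v → Reach G S v u
  reach-sym here = here
  reach-sym (step e e∈ j r) = reach-trans (reach-sym r) (step e e∈ (joins-sym j) here)

  reach-tail : ∀ {S g u y x} → g ∈ S → Joins (ends G g) u y → Reach G S y x → Reach G S (tail g) x
  reach-tail {S} {g} g∈ (inj₁ (a , b)) r = step g g∈ (joins-ends g) (subst (λ z → Reach G S z _) (sym b) r)
  reach-tail {S} g∈ (inj₂ (a , b)) r = subst (λ z → Reach G S z _) (sym a) r

  -- S is rooted at x when every edge of S reaches x inside S.  For a nonempty S
  -- this is the same as S spanning a connected subgraph.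
  Rooted : Subset (m G) → Fin (V G) → Set
  Rooted S x = ∀ f → f ∈ S → Reach G S (tail f) x

  rooted⇒connected : ∀ {S x} → Rooted S x → ConnectedSub G S
  rooted⇒connected rooted e f e∈ f∈ = reach-trans (rooted e e∈) (reach-sym (rooted f f∈))

  connected⇒rooted : ∀ {S f} → ConnectedSub G S → f ∈ S → Rooted S (tail f)
  connected⇒rooted connected f∈ g g∈ = connected g _ g∈ f∈

  rooted-∅ : ∀ x → Rooted ⊥ x
  rooted-∅ x f f∈ = ⊥-elim (∉⊥ f∈)

  rooted-insert : ∀ {A g x} → Rooted A x → Reach G (A ∪ ⁅ g ⁆) (tail g) x → Rooted (A ∪ ⁅ g ⁆) x
  rooted-insert {A} {g} rootedA g-reaches h h∈ with x∈p∪q⁻ A ⁅ g ⁆ h∈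
  ... | inj₁ h∈A = reach-mono (p⊆p∪q ⁅ g ⁆) (rootedA h h∈A)
  ... | inj₂ h∈g rewrite x∈⁅y⁆⇒x≡y g h∈g = g-reaches

  Extension : Subset (m G) → Subset (m G) → Fin (V G) → Set
  Extension A U x = ∃ λ g → g ∈ U × g ∉ A × Rooted (A ∪ ⁅ g ⁆) x

  walk-into : ∀ {A U x} → Rooted A x → ∀ {u} → Reach G U u x → Reach G A u x ⊎ Extension A U x
  walk-into rootedA here = inj₁ here
  walk-into {A} rootedA (step g g∈U j r) with walk-into rootedA r
  ... | inj₂ extension = inj₂ extension
  ... | inj₁ rA with g ∈? A
  ...   | yes g∈A = inj₁ (step g g∈A j rA)
  ...   | no g∉A = inj₂ (g , g∈U , g∉A , rooted-insert rootedA
                           (reach-tail (∈-insert A g) j (reach-mono (p⊆p∪q ⁅ g ⁆) rA)))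

  grow-one : ∀ {A U x} → A ⊆ U → Rooted A x → Rooted U x → ∣ A ∣ < ∣ U ∣ → Extension A U x
  grow-one {A} {U} A⊆U rootedA rootedU A<U with missing U A A⊆U A<U
  ... | f , f∈U , f∉A with walk-into rootedA (rootedU f f∈U)
  ...   | inj₂ extension = extension
  ...   | inj₁ rA = f , f∈U , f∉A , rooted-insert rootedA (reach-mono (p⊆p∪q ⁅ f ⁆) rA)

  grow : ∀ d {A U x} → A ⊆ U → Rooted A x → Rooted U x → ∣ A ∣ + d ≤ ∣ U ∣ →
         ∃ λ B → A ⊆ B × B ⊆ U × Rooted B x × ∣ B ∣ ≡ ∣ A ∣ + d
  grow zero {A} A⊆U rootedA _ _ = A , (λ h∈ → h∈) , A⊆U , rootedA , sym (ℕP.+-identityʳ _)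
  grow (suc d) {A} {U} A⊆U rootedA rootedU A+d≤U
    with grow-one A⊆U rootedA rootedU (ℕP.<-≤-trans (ℕP.m<m+n ∣ A ∣ (s≤s z≤n)) A+d≤U)
  ... | g , g∈U , g∉A , rootedA' with grow d (∪-⊆ A⊆U (⁅⁆-⊆ g∈U)) rootedA' rootedU
      (subst (λ z → z + d ≤ ∣ U ∣) (sym (card-insert A g g∉A))
             (subst (_≤ ∣ U ∣) (ℕP.+-suc ∣ A ∣ d) A+d≤U))
  ... | B , A'⊆B , B⊆U , rootedB , size =
    B , (λ h∈ → A'⊆B (p⊆p∪q ⁅ g ⁆ h∈)) , B⊆U , rootedB ,
    trans size (trans (cong (_+ d) (card-insert A g g∉A)) (sym (ℕP.+-suc ∣ A ∣ d)))

  rooted-cover : ∀ {S P Q x} → P ⊆ S → Q ⊆ S → Rooted P x → Rooted Q x →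
                 (∀ {h} → h ∈ S → h ∈ P ⊎ h ∈ Q) → Rooted S x
  rooted-cover P⊆S Q⊆S rootedP rootedQ cover h h∈S with cover h∈S
  ... | inj₁ h∈P = reach-mono P⊆S (rootedP h h∈P)
  ... | inj₂ h∈Q = reach-mono Q⊆S (rootedQ h h∈Q)

  attach : ∀ {X e r c} → Rooted X c → Joins (ends G e) r c → Rooted (X ∪ ⁅ e ⁆) r
  attach {X} {e} rootedX eJ h h∈ =
    reach-trans (rooted-insert rootedX (reach-tail (∈-insert X e) eJ here) h h∈)
                (step e (∈-insert X e) (joins-sym eJ) here)

module Splitting (G : Graph) where
  open Walks G

  Covered : Subset (m G) → Fin (V G) → Fin (V G) → Set
  Covered X c v = v ≡ c ⊎ ∃ λ g → g ∈ X × (tail g ≡ v ⊎ head g ≡ v)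

  covered? : ∀ X c v → Dec (Covered X c v)
  covered? X c v =
    (v FinP.≟ c) ⊎-dec FinP.any? (λ g → (g ∈? X) ×-dec ((tail g FinP.≟ v) ⊎-dec (head g FinP.≟ v)))

  Touches : Subset (m G) → Fin (V G) → Fin (m G) → Set
  Touches X c f = Covered X c (tail f) ⊎ Covered X c (head f)

  Closed : Subset (m G) → Subset (m G) → Fin (V G) → Set
  Closed U X c = ∀ f → f ∈ U → f ∉ X → ¬ Touches X c f

  covered-reach : ∀ {X c v} → Rooted X c → Covered X c v → Reach G X v c
  covered-reach rootedX (inj₁ refl) = here
  covered-reach rootedX (inj₂ (g , g∈ , inj₁ refl)) = rootedX g g∈
  covered-reach rootedX (inj₂ (g , g∈ , inj₂ refl)) = step g g∈ (joins-sym (joins-ends g)) (rootedX g g∈)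

  -- Adding touching edges one at a time, a rooted X ⊆ U grows to a closed rooted
  -- X' ⊆ U: the component of U containing the root.  N bounds the number of steps.
  saturate : ∀ N {U X c} → X ⊆ U → Rooted X c → ∣ U ∣ ≤ N + ∣ X ∣ →
             ∃ λ X' → X' ⊆ U × Rooted X' c × Closed U X' c
  saturate N {U} {X} {c} X⊆U rootedX U≤N+X
    with FinP.any? (λ f → (f ∈? U) ×-dec (¬? (f ∈? X) ×-dec
                           (covered? X c (tail f) ⊎-dec covered? X c (head f))))
  ... | no none = X , X⊆U , rootedX , λ f f∈U f∉X touches → none (f , f∈U , f∉X , touches)
  saturate zero {U} {X} X⊆U rootedX U≤X | yes (f , f∈U , f∉X , _) =
    ⊥-elim (ℕP.<-irrefl refl
      (ℕP.≤-trans X<X∪f (ℕP.≤-trans (p⊆q⇒∣p∣≤∣q∣ (∪-⊆ X⊆U (⁅⁆-⊆ f∈U))) U≤X)))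
    where
    X<X∪f : ∣ X ∣ < ∣ X ∪ ⁅ f ⁆ ∣
    X<X∪f = ℕP.≤-reflexive (sym (card-insert X f f∉X))
  saturate (suc N) {U} {X} {c} X⊆U rootedX U≤N+X | yes (f , f∈U , f∉X , touches) =
    saturate N (∪-⊆ X⊆U (⁅⁆-⊆ f∈U)) (rooted-insert rootedX (tail-reaches touches))
      (subst (∣ U ∣ ≤_) (trans (sym (ℕP.+-suc N ∣ X ∣)) (cong (λ z → N + z) (sym (card-insert X f f∉X))))
             U≤N+X)
    where
    tail-reaches : Touches X c f → Reach G (X ∪ ⁅ f ⁆) (tail f) c
    tail-reaches (inj₁ covered) = reach-mono (p⊆p∪q ⁅ f ⁆) (covered-reach rootedX covered)
    tail-reaches (inj₂ covered) =
      step f (∈-insert X f) (joins-ends f) (reach-mono (p⊆p∪q ⁅ f ⁆) (covered-reach rootedX covered))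

  -- A walk in S to r from a
  -- vertex not covered by X (nor c) can be cut at its first visit of r into a walk
  -- avoiding e and X: it never reaches a covered vertex without using e or X.
  escape : ∀ {S X r c e} → Joins (ends G e) r c → Closed (S ─ ⁅ e ⁆) X c →
           ∀ {u} → Reach G S u r → ¬ Covered X c u → Reach G ((S ─ ⁅ e ⁆) ─ X) u r
  escape eJ closed here uncovered = here
  escape {S} {X} {r} {c} {e} eJ closed {u} (step g g∈S j rest) uncovered with u FinP.≟ r
  ... | yes refl = here
  ... | no u≢r = step g g∈Y j (escape eJ closed rest next-uncovered)
    where
    g≢e : g ≢ e
    g≢e refl with endpoint-of eJ (endpoint-left j)
    ... | inj₁ u≡r = u≢r u≡r
    ... | inj₂ u≡c = uncovered (inj₁ u≡c)
    g∈U : g ∈ S ─ ⁅ e ⁆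
    g∈U = x∈p∧x∉q⇒x∈p─q g∈S (x≢y⇒x∉⁅y⁆ g≢e)
    g∉X : g ∉ X
    g∉X g∈X = uncovered (inj₂ (g , g∈X , endpoint-left j))
    g∈Y : g ∈ (S ─ ⁅ e ⁆) ─ X
    g∈Y = x∈p∧x∉q⇒x∈p─q g∈U g∉X
    next-uncovered : ¬ Covered X c _
    next-uncovered covered with endpoint-right j
    ... | inj₁ x = closed g g∈U g∉X (inj₁ (subst (Covered X c) (sym x) covered))
    ... | inj₂ x = closed g g∈U g∉X (inj₂ (subst (Covered X c) (sym x) covered))

  final-edge : ∀ {S u v} → Reach G S u v → u ≡ v ⊎ ∃ λ g → g ∈ S × ∃ λ c → Joins (ends G g) v c
  final-edge here = inj₁ refl
  final-edge (step g g∈ j rest) with final-edge rest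
  ... | inj₂ edge = inj₂ edge
  ... | inj₁ refl = inj₂ (g , g∈ , _ , joins-sym j)

  edge-at-root : ∀ {S r} → Rooted S r → Nonempty S → ∃ λ e → e ∈ S × ∃ λ c → Joins (ends G e) r c
  edge-at-root rooted (f , f∈) with final-edge (rooted f f∈)
  ... | inj₁ f-at-r = f , f∈ , head f , inj₁ (f-at-r , refl)
  ... | inj₂ edge = edge

  record Piece (t : ℕ) (S : Subset (m G)) (r : Fin (V G)) : Set where
    field
      A           : Subset (m G)
      A⊆S         : A ⊆ S
      connected   : ConnectedSub G A
      t≤A         : t ≤ ∣ A ∣
      near-t      : ∣ A ∣ ≤ t ⊎ ∣ A ∣ + 2 ≤ t + t
      rest-rooted : Rooted (S ─ A) r

  -- Removing an edge e at the root r of S splits S ─ {e} into the component X of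
  -- the other endpoint c and the rest Y, which is still rooted at r.
  module Decomposition {S : Subset (m G)} {r c : Fin (V G)} {e : Fin (m G)}
           (rootedS : Rooted S r) (e∈S : e ∈ S) (eJ : Joins (ends G e) r c)
           (X : Subset (m G)) (X⊆U : X ⊆ S ─ ⁅ e ⁆) (rootedX : Rooted X c)
           (closedX : Closed (S ─ ⁅ e ⁆) X c) where

    U Y : Subset (m G)
    U = S ─ ⁅ e ⁆
    Y = U ─ X

    U⊆S : U ⊆ S
    U⊆S = p─q⊆p S ⁅ e ⁆
    X⊆S : X ⊆ S
    X⊆S h∈ = U⊆S (X⊆U h∈)
    Y⊆S : Y ⊆ S
    Y⊆S h∈ = U⊆S (p─q⊆p U X h∈)

    e∉U : e ∉ U
    e∉U e∈U = proj₂ (x∈p─q⁻ S ⁅ e ⁆ e∈U) (x∈⁅x⁆ e)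
    e∉X : e ∉ X
    e∉X e∈X = e∉U (X⊆U e∈X)
    e∉Y : e ∉ Y
    e∉Y e∈Y = e∉U (p─q⊆p U X e∈Y)
    X∩Y=∅ : ∀ {h} → h ∈ X → h ∉ Y
    X∩Y=∅ h∈X h∈Y = proj₂ (x∈p─q⁻ U X h∈Y) h∈X

    classify : ∀ {h} → h ∈ S → h ≡ e ⊎ h ∈ X ⊎ h ∈ Y
    classify {h} h∈S with h FinP.≟ e
    ... | yes h≡e = inj₁ h≡e
    ... | no h≢e with h ∈? X
    ...   | yes h∈X = inj₂ (inj₁ h∈X)
    ...   | no h∉X =
      inj₂ (inj₂ (x∈p∧x∉q⇒x∈p─q (x∈p∧x∉q⇒x∈p─q h∈S (x≢y⇒x∉⁅y⁆ h≢e)) h∉X))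

    size-S : ∣ S ∣ ≡ suc (∣ X ∣ + ∣ Y ∣)
    size-S = trans (card-split S ⁅ e ⁆ (⁅⁆-⊆ e∈S))
                 (cong₂ _+_ (∣⁅x⁆∣≡1 e) (card-split U X X⊆U))

    rootedY : Rooted Y r
    rootedY f f∈Y with x∈p─q⁻ U X f∈Y
    ... | f∈U , f∉X =
      escape eJ closedX (rootedS f (U⊆S f∈U)) (λ covered → closedX f f∈U f∉X (inj₁ covered))

    P : Subset (m G)
    P = X ∪ ⁅ e ⁆

    P⊆S : P ⊆ S
    P⊆S = ∪-⊆ X⊆S (⁅⁆-⊆ e∈S)

    size-P : ∣ P ∣ ≡ suc ∣ X ∣
    size-P = card-insert X e e∉X

    rooted-S─P : Rooted (S ─ P) r
    rooted-S─P h h∈ = reach-mono Y⊆S─P (rootedY h (in-Y h∈))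
      where
      Y∩P=∅ : ∀ {h} → h ∈ Y → h ∉ P
      Y∩P=∅ {h} h∈Y h∈P with x∈p∪q⁻ X ⁅ e ⁆ h∈P
      ... | inj₁ h∈X = X∩Y=∅ h∈X h∈Y
      ... | inj₂ h∈e = e∉Y (subst (_∈ Y) (x∈⁅y⁆⇒x≡y e h∈e) h∈Y)
      Y⊆S─P : Y ⊆ S ─ P
      Y⊆S─P h∈Y = x∈p∧x∉q⇒x∈p─q (Y⊆S h∈Y) (Y∩P=∅ h∈Y)
      in-Y : ∀ {h} → h ∈ S ─ P → h ∈ Y
      in-Y h∈ with x∈p─q⁻ S P h∈
      ... | h∈S , h∉P with classify h∈S
      ...   | inj₁ refl = ⊥-elim (h∉P (∈-insert X e))
      ...   | inj₂ (inj₁ h∈X) = ⊥-elim (h∉P (p⊆p∪q ⁅ e ⁆ h∈X))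
      ...   | inj₂ (inj₂ h∈Y) = h∈Y

    -- A piece cut from X (rooted at c) is a piece of S: the rest of X is joined
    -- to r through e, and Y is untouched.
    piece-of-X : ∀ {t} → Piece t X c → Piece t S r
    piece-of-X piece = record
      { A = A ; A⊆S = λ h∈ → X⊆S (A⊆S h∈) ; connected = connected ; t≤A = t≤A ; near-t = near-t
      ; rest-rooted = rooted-cover X─A+e⊆ Y⊆ (attach rest-rooted eJ) rootedY cover }
      where
      open Piece piece
      e∉A : e ∉ A
      e∉A e∈A = e∉X (A⊆S e∈A)
      X─A+e⊆ : (X ─ A) ∪ ⁅ e ⁆ ⊆ S ─ A
      X─A+e⊆ = ∪-⊆ (λ h∈ → let (h∈X , h∉A) = x∈p─q⁻ X A h∈ in x∈p∧x∉q⇒x∈p─q (X⊆S h∈X) h∉A)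
                   (⁅⁆-⊆ (x∈p∧x∉q⇒x∈p─q e∈S e∉A))
      Y⊆ : Y ⊆ S ─ A
      Y⊆ h∈Y = x∈p∧x∉q⇒x∈p─q (Y⊆S h∈Y) (λ h∈A → X∩Y=∅ (A⊆S h∈A) h∈Y)
      cover : ∀ {h} → h ∈ S ─ A → h ∈ (X ─ A) ∪ ⁅ e ⁆ ⊎ h ∈ Y
      cover h∈ with x∈p─q⁻ S A h∈
      ... | h∈S , h∉A with classify h∈S
      ...   | inj₁ refl = inj₁ (∈-insert _ e)
      ...   | inj₂ (inj₁ h∈X) = inj₁ (p⊆p∪q ⁅ e ⁆ (x∈p∧x∉q⇒x∈p─q h∈X h∉A))
      ...   | inj₂ (inj₂ h∈Y) = inj₂ h∈Y

    -- A piece cut from Y (rooted at r) is a piece of S: X ∪ {e} is untouched.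
    piece-of-Y : ∀ {t} → Piece t Y r → Piece t S r
    piece-of-Y piece = record
      { A = A ; A⊆S = λ h∈ → Y⊆S (A⊆S h∈) ; connected = connected ; t≤A = t≤A ; near-t = near-t
      ; rest-rooted = rooted-cover P⊆ Y─A⊆ (attach rootedX eJ) rest-rooted cover }
      where
      open Piece piece
      P⊆ : P ⊆ S ─ A
      P⊆ {h} h∈P = x∈p∧x∉q⇒x∈p─q (P⊆S h∈P) (not-in-A (x∈p∪q⁻ X ⁅ e ⁆ h∈P))
        where
        not-in-A : h ∈ X ⊎ h ∈ ⁅ e ⁆ → h ∉ A
        not-in-A (inj₁ h∈X) h∈A = X∩Y=∅ h∈X (A⊆S h∈A)
        not-in-A (inj₂ h∈e) h∈A = e∉Y (A⊆S (subst (_∈ A) (x∈⁅y⁆⇒x≡y e h∈e) h∈A))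
      Y─A⊆ : Y ─ A ⊆ S ─ A
      Y─A⊆ h∈ = let (h∈Y , h∉A) = x∈p─q⁻ Y A h∈ in x∈p∧x∉q⇒x∈p─q (Y⊆S h∈Y) h∉A
      cover : ∀ {h} → h ∈ S ─ A → h ∈ P ⊎ h ∈ Y ─ A
      cover h∈ with x∈p─q⁻ S A h∈
      ... | h∈S , h∉A with classify h∈S
      ...   | inj₁ refl = inj₁ (∈-insert _ e)
      ...   | inj₂ (inj₁ h∈X) = inj₁ (p⊆p∪q ⁅ e ⁆ h∈X)
      ...   | inj₂ (inj₂ h∈Y) = inj₂ (x∈p∧x∉q⇒x∈p─q h∈Y h∉A)

  -- Remove
  -- an edge e at r; the piece is found inside X or inside Y when one of them is
  -- large enough, is X ∪ {e} when that has size t, and otherwise |S| ≤ 2t − 2.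
  -- N bounds |S| and drives the induction.
  cut-piece : ∀ N t {S r} → ∣ S ∣ ≤ N → Rooted S r → 1 ≤ t → t ≤ ∣ S ∣ → Piece t S r
  cut-piece zero t S≤0 _ 1≤t t≤S with ℕP.≤-trans 1≤t (ℕP.≤-trans t≤S S≤0)
  ... | ()
  cut-piece (suc N) t {S} {r} S≤N rootedS 1≤t t≤S
    with edge-at-root rootedS (nonempty S (ℕP.≤-trans 1≤t t≤S))
  ... | e , e∈S , c , eJ
    with saturate ∣ S ─ ⁅ e ⁆ ∣ {S ─ ⁅ e ⁆} {⊥} {c} ⊥⊆ (rooted-∅ c) (ℕP.m≤m+n _ _)
  ... | X , X⊆U , rootedX , closedX = choose
    where
    open Decomposition rootedS e∈S eJ X X⊆U rootedX closedX

    X+Y<S : ∣ X ∣ + ∣ Y ∣ < suc N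
    X+Y<S = subst (_≤ suc N) size-S S≤N
    X≤N : ∣ X ∣ ≤ N
    X≤N = ℕP.≤-pred (ℕP.≤-trans (s≤s (ℕP.m≤m+n ∣ X ∣ ∣ Y ∣)) X+Y<S)
    Y≤N : ∣ Y ∣ ≤ N
    Y≤N = ℕP.≤-pred (ℕP.≤-trans (s≤s (ℕP.m≤n+m ∣ Y ∣ ∣ X ∣)) X+Y<S)

    choose : Piece t S r
    choose with t ≤? ∣ X ∣
    ... | yes t≤X =
      piece-of-X (cut-piece N t X≤N rootedX 1≤t t≤X)
    ... | no t≰X with suc ∣ X ∣ ℕ.≟ t
    ...   | yes 1+X≡t = record
            { A = P ; A⊆S = P⊆S ; connected = rooted⇒connected (attach rootedX eJ)
            ; t≤A = ℕP.≤-reflexive (sym (trans size-P 1+X≡t))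
            ; near-t = inj₁ (ℕP.≤-reflexive (trans size-P 1+X≡t)) ; rest-rooted = rooted-S─P }
    ...   | no 1+X≢t with t ≤? ∣ Y ∣
    ...     | yes t≤Y =
      piece-of-Y (cut-piece N t Y≤N rootedY 1≤t t≤Y)
    ...     | no t≰Y = record
            { A = S ; A⊆S = λ h∈ → h∈ ; connected = rooted⇒connected rootedS ; t≤A = t≤S
            ; near-t = inj₂ (subst (λ z → z + 2 ≤ t + t) (sym size-S)
                         (small-halves (ℕP.≤∧≢⇒< (ℕP.≰⇒> t≰X) 1+X≢t) (ℕP.≰⇒> t≰Y)))
            ; rest-rooted = λ h h∈ → ⊥-elim (proj₂ (x∈p─q⁻ S S h∈) (proj₁ (x∈p─q⁻ S S h∈))) }
      where
      small-halves : ∀ {x y} → suc (suc x) ≤ t → suc y ≤ t → suc (x + y) + 2 ≤ t + t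
      small-halves {x} {y} x+2≤t y+1≤t = subst (_≤ t + t) (regroup x y) (ℕP.+-mono-≤ x+2≤t y+1≤t)
        where
        regroup : ∀ x y → suc (suc x) + suc y ≡ suc (x + y) + 2
        regroup = ℕRing.solve-∀

-- The index range ⌈n/3⌉ ≤ j ≤ ⌊n/2⌋ of the minimum in the definition of g,
-- with ⌈n/3⌉ written (n + 2) / 3.
third-upper : ∀ n → (n + 2) / 3 * 3 ≤ n + 2
third-upper n = m/n*n≤m (n + 2) 3

third-lower : ∀ n → n ≤ (n + 2) / 3 * 3
third-lower n = ℕP.+-cancelʳ-≤ 2 n ((n + 2) / 3 * 3)
  (begin
    n + 2                        ≡⟨ m≡m%n+[m/n]*n (n + 2) 3 ⟩
    (n + 2) % 3 + (n + 2) / 3 * 3 ≤⟨ ℕP.+-monoˡ-≤ _ (ℕP.≤-pred (m%n<n (n + 2) 3)) ⟩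
    2 + (n + 2) / 3 * 3          ≡⟨ ℕP.+-comm 2 _ ⟩
    (n + 2) / 3 * 3 + 2          ∎)
  where open ℕP.≤-Reasoning

half-lower : ∀ n → n ≤ n / 2 * 2 + 1
half-lower n = begin
  n                ≡⟨ m≡m%n+[m/n]*n n 2 ⟩
  n % 2 + n / 2 * 2 ≤⟨ ℕP.+-monoˡ-≤ _ (ℕP.≤-pred (m%n<n n 2)) ⟩
  1 + n / 2 * 2     ≡⟨ ℕP.+-comm 1 _ ⟩
  n / 2 * 2 + 1     ∎
  where open ℕP.≤-Reasoning

lo-positive : ∀ {n lo} → 1 ≤ n → n ≤ lo * 3 → 1 ≤ lo
lo-positive {lo = zero} 1≤n n≤0 with ℕP.≤-trans 1≤n n≤0
... | ()
lo-positive {lo = suc lo} _ _ = s≤s z≤n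

lo≤n : ∀ {n lo} → 1 ≤ n → lo * 3 ≤ n + 2 → lo ≤ n
lo≤n {suc n} {lo} _ 3lo≤n+2 =
  ℕP.*-cancelʳ-≤ lo (suc n) 3
    (ℕP.≤-trans 3lo≤n+2 (subst (suc n + 2 ≤_) (sym (regroup n)) (ℕP.m≤m+n _ _)))
  where
  regroup : ∀ n → suc n * 3 ≡ suc n + 2 + (n + n)
  regroup = ℕRing.solve-∀

two-lo≤n : ∀ {n lo} → 2 ≤ n → lo * 3 ≤ n + 2 → lo * 2 ≤ n
two-lo≤n {n} {lo} 2≤n 3lo≤n+2 with lo * 2 ≤? n
... | yes 2lo≤n = 2lo≤n
... | no 2lo≰n = ⊥-elim (ℕP.<-irrefl refl (ℕP.≤-trans 2≤n n≤1))
  where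
  open ℕP.≤-Reasoning
  n≤1 : n ≤ 1
  n≤1 = ℕP.+-cancelˡ-≤ (n * 2) n 1 (ℕP.+-cancelʳ-≤ 3 (n * 2 + n) (n * 2 + 1) (begin
    n * 2 + n + 3   ≡⟨ regroup₁ n ⟩
    suc n * 3       ≤⟨ ℕP.*-monoˡ-≤ 3 (ℕP.≰⇒> 2lo≰n) ⟩
    lo * 2 * 3      ≡⟨ regroup₂ lo ⟩
    lo * 3 * 2      ≤⟨ ℕP.*-monoˡ-≤ 2 3lo≤n+2 ⟩
    (n + 2) * 2     ≡⟨ regroup₃ n ⟩
    n * 2 + 1 + 3   ∎))
    where
    regroup₁ : ∀ n → n * 2 + n + 3 ≡ suc n * 3
    regroup₁ = ℕRing.solve-∀
    regroup₂ : ∀ lo → lo * 2 * 3 ≡ lo * 3 * 2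
    regroup₂ = ℕRing.solve-∀
    regroup₃ : ∀ n → (n + 2) * 2 ≡ n * 2 + 1 + 3
    regroup₃ = ℕRing.solve-∀

piece-fits : ∀ {n lo a} → 2 ≤ n → lo * 3 ≤ n + 2 → (a ≤ lo ⊎ a + 2 ≤ lo + lo) → a + lo ≤ n
piece-fits {n} {lo} {a} 2≤n 3lo≤n+2 (inj₁ a≤lo) =
  ℕP.≤-trans (ℕP.+-monoˡ-≤ lo a≤lo) (subst (_≤ n) (double lo) (two-lo≤n {n} {lo} 2≤n 3lo≤n+2))
  where
  double : ∀ lo → lo * 2 ≡ lo + lo
  double = ℕRing.solve-∀
piece-fits {n} {lo} {a} 2≤n 3lo≤n+2 (inj₂ a+2≤2lo) = ℕP.+-cancelʳ-≤ 2 (a + lo) n (begin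
  a + lo + 2    ≡⟨ regroup₁ a lo ⟩
  a + 2 + lo    ≤⟨ ℕP.+-monoˡ-≤ lo a+2≤2lo ⟩
  lo + lo + lo  ≡⟨ regroup₂ lo ⟩
  lo * 3        ≤⟨ 3lo≤n+2 ⟩
  n + 2         ∎)
  where
  open ℕP.≤-Reasoning
  regroup₁ : ∀ a lo → a + lo + 2 ≡ a + 2 + lo
  regroup₁ = ℕRing.solve-∀
  regroup₂ : ∀ lo → lo + lo + lo ≡ lo * 3
  regroup₂ = ℕRing.solve-∀

partner : ∀ {n lo h a} → n ≤ h * 2 + 1 → lo ≤ a → a + lo ≤ n →
          ∃[ j ] (lo ≤ j × j ≤ h × (j ≡ a ⊎ j ≡ n ∸ a))
partner {n} {lo} {h} {a} n≤2h+1 lo≤a a+lo≤n with a ≤? h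
... | yes a≤h = a , lo≤a , a≤h , inj₁ refl
... | no a≰h = n ∸ a , lo≤n-a , n-a≤h , inj₂ refl
  where
  lo≤n-a : lo ≤ n ∸ a
  lo≤n-a = subst (_≤ n ∸ a) (ℕP.m+n∸m≡n a lo) (ℕP.∸-monoˡ-≤ a a+lo≤n)
  n≤h+a : n ≤ h + a
  n≤h+a = ℕP.≤-trans n≤2h+1 (subst (_≤ h + a) (regroup h) (ℕP.+-monoʳ-≤ h (ℕP.≰⇒> a≰h)))
    where
    regroup : ∀ h → h + suc h ≡ h * 2 + 1
    regroup = ℕRing.solve-∀
  n-a≤h : n ∸ a ≤ h
  n-a≤h = subst (n ∸ a ≤_) (ℕP.m+n∸n≡m h a) (ℕP.∸-monoˡ-≤ a n≤h+a)

≤ᵇ-true : ∀ {n k} → (n ≤ᵇ k) ≡ true → n ≤ k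
≤ᵇ-true {n} {k} n≤ᵇk = ℕP.≤ᵇ⇒≤ n k (subst T (sym n≤ᵇk) _)

≤ᵇ-false : ∀ {n k} → (n ≤ᵇ k) ≡ false → k < n
≤ᵇ-false {n} {k} n≰ᵇk = ℕP.≰⇒> (λ n≤k → subst T n≰ᵇk (ℕP.≤⇒≤ᵇ n≤k))

even-k : ∀ k → (k % 2 ≡ᵇ 1) ≡ false → k ≡ 2 * (k / 2)
even-k k k%2≢1 with k % 2 | m≡m%n+[m/n]*n k 2 | m%n<n k 2
... | zero | k≡ | _ = trans k≡ (ℕP.*-comm (k / 2) 2)
... | suc zero | _ | _ with () ← k%2≢1
... | suc (suc _) | _ | s≤s (s≤s ())

split-min : ℕ → ℕ → ℕ → ℤ
split-min f n k = minRange (λ j → gF f (n ∸ j) k +ℤ gF f j k) ((n + 2) / 3) (n / 2 ∸ (n + 2) / 3)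

minRange-≤ : ∀ F lo c j → lo ≤ j → j ≤ lo + c → minRange F lo c ≤ℤ F j
minRange-≤ F lo zero j lo≤j j≤lo
  rewrite ℕP.≤-antisym lo≤j (subst (j ≤_) (ℕP.+-identityʳ lo) j≤lo) = ℤP.≤-refl
minRange-≤ F lo (suc c) j lo≤j j≤lo+c with lo ℕ.≟ j
... | yes refl = ℤP.i⊓j≤i _ _
... | no lo≢j =
  ℤP.≤-trans (ℤP.i⊓j≤j _ _)
    (minRange-≤ F (suc lo) c j (ℕP.≤∧≢⇒< lo≤j lo≢j) (subst (j ≤_) (ℕP.+-suc lo c) j≤lo+c))

shifted-bound : ∀ n r {c s x : ℤ} → c ≤ℤ s +ℤ x → x ≤ℤ + r → + n -ℤ + (r + n) +ℤ c ≤ℤ s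
shifted-bound n r {c} {s} {x} c≤s+x x≤r = begin
  + n -ℤ + (r + n) +ℤ c     ≡⟨ cong (λ z → + n -ℤ z +ℤ c) (ℤP.pos-+ r n) ⟩
  + n -ℤ (+ r +ℤ + n) +ℤ c ≡⟨ regroup (+ n) (+ r) c ⟩
  c -ℤ + r                  ≤⟨ ℤP.+-monoʳ-≤ c (ℤP.neg-mono-≤ x≤r) ⟩
  c -ℤ x                    ≤⟨ ℤP.+-monoˡ-≤ (- x) c≤s+x ⟩
  s +ℤ x -ℤ x               ≡⟨ cancel s x ⟩
  s                         ∎
  where
  open ℤP.≤-Reasoning
  regroup : ∀ n r c → n -ℤ (r +ℤ n) +ℤ c ≡ c -ℤ r
  regroup = ℤRing.solve-∀
  cancel : ∀ s x → s +ℤ x -ℤ x ≡ s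
  cancel = ℤRing.solve-∀

module Bounds (k : ℕ) (1≤k : 1 ≤ k) (G : Graph) (connectedG : IsConnected G) (k≤m : k ≤ m G)
              (w : Fin (m G) → ℤ) (±1 : IsWeighing G w) (positive : LocalPositive k G w) where
  open Walks G
  open Splitting G
  open SignBounds w ±1

  extend-to-k : ∀ S → 1 ≤ ∣ S ∣ → ∣ S ∣ ≤ k → ConnectedSub G S →
                ∃ λ B → S ⊆ B × ConnectedSub G B × ∣ B ∣ ≡ k
  extend-to-k S 1≤S S≤k connectedS with nonempty S 1≤S
  ... | f , f∈S
    with grow (k ∸ ∣ S ∣) ⊆⊤ (connected⇒rooted connectedS f∈S) (λ g _ → connectedG (tail g) (tail f))
              (subst₂ _≤_ (sym (ℕP.m+[n∸m]≡n S≤k)) (sym (∣⊤∣≡n (m G))) k≤m)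
  ... | B , S⊆B , _ , rootedB , sizeB =
    B , S⊆B , rooted⇒connected rootedB , trans sizeB (ℕP.m+[n∸m]≡n S≤k)

  -- Sets with at most k edges: if every connected set of k edges weighs at least c,
  -- then a connected S with n ≤ k edges weighs at least n − k + c, since the
  -- k − n edges added to reach size k weigh at most k − n.
  small-bound : ∀ c → (∀ B → ∣ B ∣ ≡ k → ConnectedSub G B → c ≤ℤ wt w B) →
                ∀ S → 1 ≤ ∣ S ∣ → ∣ S ∣ ≤ k → ConnectedSub G S →
                + ∣ S ∣ -ℤ + k +ℤ c ≤ℤ wt w S
  small-bound c heavy S 1≤S S≤k connectedS with extend-to-k S 1≤S S≤k connectedS
  ... | B , S⊆B , connectedB , sizeB =
    subst (λ z → + ∣ S ∣ -ℤ + z +ℤ c ≤ℤ wt w S) k-split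
      (shifted-bound ∣ S ∣ ∣ B ─ S ∣ (subst (c ≤ℤ_) (wt-split w B S S⊆B) (heavy B sizeB connectedB))
                     (wt-≤-size (B ─ S)))
    where
    k-split : ∣ B ─ S ∣ + ∣ S ∣ ≡ k
    k-split = trans (ℕP.+-comm ∣ B ─ S ∣ ∣ S ∣) (trans (sym (card-split B S S⊆B)) sizeB)

  odd-bound : ∀ S → 1 ≤ ∣ S ∣ → ∣ S ∣ ≤ k → ConnectedSub G S →
              + ∣ S ∣ -ℤ + k +ℤ 1ℤ ≤ℤ wt w S
  odd-bound = small-bound 1ℤ (λ B sizeB connectedB → ℤP.i<j⇒suc[i]≤j (positive B sizeB connectedB))

  even-bound : ∀ q → k ≡ 2 * q → ∀ S → 1 ≤ ∣ S ∣ → ∣ S ∣ ≤ k → ConnectedSub G S →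
               + ∣ S ∣ -ℤ + k +ℤ + 2 ≤ℤ wt w S
  even-bound q k-even = small-bound (+ 2) λ B sizeB connectedB →
    wt-even-positive B q (trans sizeB k-even) (positive B sizeB connectedB)

  -- The induction hypothesis for fuel f: the bound gF f holds for sets of at most f edges.
  Bound : ℕ → Set
  Bound f = ∀ B → 1 ≤ ∣ B ∣ → ∣ B ∣ ≤ f → ConnectedSub G B → gF f ∣ B ∣ k ≤ℤ wt w B

  -- First term of the recursion: S minus one edge contains a connected set of
  -- |S| − 1 edges, and the remaining edge weighs at least −1.
  leaf-bound : ∀ f → Bound f → ∀ S → 2 ≤ ∣ S ∣ → ∣ S ∣ ≤ suc f → ConnectedSub G S →
               gF f (∣ S ∣ ∸ 1) k -ℤ 1ℤ ≤ℤ wt w S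
  leaf-bound f IH S 2≤S S≤1+f connectedS with nonempty S (ℕP.≤-trans (s≤s z≤n) 2≤S)
  ... | f₀ , f₀∈S
    with grow (∣ S ∣ ∸ 1) ⊥⊆ (rooted-∅ (tail f₀)) (connected⇒rooted connectedS f₀∈S)
              (subst (_≤ ∣ S ∣) (sym (cong (_+ (∣ S ∣ ∸ 1)) (∣⊥∣≡0 (m G)))) (ℕP.m∸n≤m ∣ S ∣ 1))
  ... | B , _ , B⊆S , rootedB , sizeB =
    subst (_ ≤ℤ_) (sym (wt-split w S B B⊆S))
      (ℤP.+-mono-≤ (subst (λ z → gF f z k ≤ℤ wt w B) B≡S-1 (IH B 1≤B B≤f (rooted⇒connected rootedB)))
                   (subst (λ z → - (+ z) ≤ℤ wt w (S ─ B)) one-left (wt-≥-size (S ─ B))))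
    where
    B≡S-1 : ∣ B ∣ ≡ ∣ S ∣ ∸ 1
    B≡S-1 = trans sizeB (cong (_+ (∣ S ∣ ∸ 1)) (∣⊥∣≡0 (m G)))
    1≤B : 1 ≤ ∣ B ∣
    1≤B = subst (1 ≤_) (sym B≡S-1) (ℕP.∸-monoˡ-≤ 1 2≤S)
    B≤f : ∣ B ∣ ≤ f
    B≤f = subst (_≤ f) (sym B≡S-1) (ℕP.∸-monoˡ-≤ 1 S≤1+f)
    one-left : ∣ S ─ B ∣ ≡ 1
    one-left = trans (card-diff S B B⊆S)
                     (trans (cong (∣ S ∣ ∸_) B≡S-1) (ℕP.m∸[m∸n]≡n (ℕP.≤-trans (s≤s z≤n) 2≤S)))

  pair-bound : ∀ f → Bound f → ∀ S A → ∣ S ∣ ≤ suc f → A ⊆ S → ConnectedSub G A →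
               ConnectedSub G (S ─ A) → 1 ≤ ∣ A ∣ → ∣ A ∣ < ∣ S ∣ →
               gF f ∣ A ∣ k +ℤ gF f (∣ S ∣ ∸ ∣ A ∣) k ≤ℤ wt w S
  pair-bound f IH S A S≤1+f A⊆S connectedA connectedR 1≤A A<S =
    subst (_ ≤ℤ_) (sym (wt-split w S A A⊆S))
      (ℤP.+-mono-≤ (IH A 1≤A (ℕP.≤-pred (ℕP.≤-trans A<S S≤1+f)) connectedA)
                   (subst (λ z → gF f z k ≤ℤ wt w (S ─ A)) size-R (IH (S ─ A) 1≤R R≤f connectedR)))
    where
    size-R : ∣ S ─ A ∣ ≡ ∣ S ∣ ∸ ∣ A ∣
    size-R = card-diff S A A⊆S
    1≤R : 1 ≤ ∣ S ─ A ∣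
    1≤R = subst (1 ≤_) (sym size-R) (ℕP.m<n⇒0<n∸m A<S)
    R≤f : ∣ S ─ A ∣ ≤ f
    R≤f = subst (_≤ f) (sym size-R) (ℕP.≤-trans (ℕP.∸-monoʳ-≤ ∣ S ∣ 1≤A) (ℕP.∸-monoˡ-≤ 1 S≤1+f))

  -- Second term of the recursion: a piece A of size about ⌈n/3⌉ gives a split
  -- n = |A| + (n − |A|) one of whose parts lies in [⌈n/3⌉, ⌊n/2⌋].
  split-bound : ∀ f → Bound f → ∀ S → 2 ≤ ∣ S ∣ → ∣ S ∣ ≤ suc f → ConnectedSub G S →
                split-min f ∣ S ∣ k ≤ℤ wt w S
  split-bound f IH S 2≤S S≤1+f connectedS with nonempty S (ℕP.≤-trans (s≤s z≤n) 2≤S)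
  ... | f₀ , f₀∈S = from-piece (cut-piece n lo ℕP.≤-refl (connected⇒rooted connectedS f₀∈S) 1≤lo
                                  (lo≤n (ℕP.≤-trans (s≤s z≤n) 2≤S) (third-upper n)))
    where
    n lo h : ℕ
    n = ∣ S ∣
    lo = (n + 2) / 3
    h = n / 2
    F : ℕ → ℤ
    F j = gF f (n ∸ j) k +ℤ gF f j k
    1≤lo : 1 ≤ lo
    1≤lo = lo-positive (ℕP.≤-trans (s≤s z≤n) 2≤S) (third-lower n)

    from-piece : Piece lo S (tail f₀) → split-min f n k ≤ℤ wt w S
    from-piece piece
      with partner (half-lower n) (Piece.t≤A piece) (piece-fits 2≤S (third-upper n) (Piece.near-t piece))
    ... | j , lo≤j , j≤h , j-choice =
      ℤP.≤-trans (minRange-≤ F lo (h ∸ lo) j lo≤j j≤lo+[h-lo]) (F-bound j-choice)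
      where
      open Piece piece
      j≤lo+[h-lo] : j ≤ lo + (h ∸ lo)
      j≤lo+[h-lo] = subst (j ≤_) (sym (ℕP.m+[n∸m]≡n (ℕP.≤-trans lo≤j j≤h))) j≤h
      A<S : ∣ A ∣ < n
      A<S = ℕP.<-≤-trans (ℕP.m<m+n ∣ A ∣ 1≤lo) (piece-fits 2≤S (third-upper n) near-t)
      both-parts : gF f ∣ A ∣ k +ℤ gF f (n ∸ ∣ A ∣) k ≤ℤ wt w S
      both-parts = pair-bound f IH S A S≤1+f A⊆S connected (rooted⇒connected rest-rooted)
                     (ℕP.≤-trans 1≤lo t≤A) A<S
      F-bound : j ≡ ∣ A ∣ ⊎ j ≡ n ∸ ∣ A ∣ → F j ≤ℤ wt w S
      F-bound (inj₁ refl) = subst (_≤ℤ wt w S) (ℤP.+-comm (gF f ∣ A ∣ k) _) both-parts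
      F-bound (inj₂ refl) =
        subst (λ z → gF f z k +ℤ gF f (n ∸ ∣ A ∣) k ≤ℤ wt w S) (sym (ℕP.m∸[m∸n]≡n (ℕP.<⇒≤ A<S)))
              both-parts

  bound : ∀ f → Bound f
  bound zero B 1≤B B≤0 _ with ℕP.≤-trans 1≤B B≤0
  ... | ()
  bound (suc f) S 1≤S S≤1+f connectedS
    with 2 * ∣ S ∣ <ᵇ k | ∣ S ∣ ≤ᵇ k in medium | k % 2 ≡ᵇ 1 in odd
  ... | true | _ | _ = wt-≥-size S
  ... | false | true | true = odd-bound S 1≤S (≤ᵇ-true medium) connectedS
  ... | false | true | false = even-bound (k / 2) (even-k k odd) S 1≤S (≤ᵇ-true medium) connectedS
  ... | false | false | _ =
    ℤP.⊔-lub (leaf-bound f (bound f) S 2≤S S≤1+f connectedS)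
             (split-bound f (bound f) S 2≤S S≤1+f connectedS)
    where
    2≤S : 2 ≤ ∣ S ∣
    2≤S = ℕP.≤-trans (s≤s 1≤k) (≤ᵇ-false medium)

lemma3p5 : (k n : ℕ) → 0 < k → 0 < n →
    (T : Graph) → IsTree T → k ≤ m T →
    (w : Fin (m T) → ℤ) → IsWeighing T w → LocalPositive k T w →
    ((S : Subset (m T)) → nEdges S ≡ n → ConnectedSub T S → g n k ≤ℤ weight T w S)
    × (m T ≡ n → g n k ≤ℤ weight T w ⊤)
lemma3p5 k n 1≤k 1≤n T (_ , connectedT , _) k≤m w ±1 positive = subsets , whole
  where
  open Bounds k 1≤k T connectedT k≤m w ±1 positive

  subsets : (S : Subset (m T)) → nEdges S ≡ n → ConnectedSub T S → g n k ≤ℤ weight T w S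
  subsets S size connectedS =
    subst (λ z → gF z z k ≤ℤ wt w S) size
      (bound ∣ S ∣ S (subst (1 ≤_) (sym size) 1≤n) ℕP.≤-refl connectedS)

  whole : m T ≡ n → g n k ≤ℤ weight T w ⊤
  whole m≡n = subsets ⊤ (trans (∣⊤∣≡n (m T)) m≡n) (λ _ _ _ _ → connectedT _ _)
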